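{- Let $p$ be a prime. For all natural numbers $\ell$ and $d$, there is no monic polynomial of degree $d$ in $\mathbb{F}_{p^\ell}[t]$ that is weakly $p$-superirreducible over $\mathbb{F}_{p^\ell}$; that is, $s_p(p^\ell,d)=0$.
   Context: For a field $R$ (here a finite field), a polynomial $f\in R[t]$ is weakly $k$-superirreducible over $R$ if $f(g(t))$ is irreducible in $R[t]$ for every polynomial $g\in R[t]$ of degree $k$. $s_k(q,d)$ denotes the number of monic weakly $k$-superirreducible polynomials of degree $d$ in $\mathbb{F}_q[t]$, where $\mathbb{F}_q$ is the finite field with $q$ elements. -}

module Defs where

open import Level using (Level; _⊔_)
open import Algebra.Bundles using (CommutativeRing)
open import Data.Nat using (ℕ; zero; suc; _<_)
open import Data.List using (List; []; _∷_; map; foldr)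
open import Data.Product using (Σ; ∃; _×_; _,_)
open import Data.Sum using (_⊎_)
open import Relation.Nullary using (¬_)

module Poly {c ℓ : Level} (R : CommutativeRing c ℓ) where
  open CommutativeRing R

  IsField : Set (c ⊔ ℓ)
  IsField = (¬ (1# ≈ 0#)) × (∀ x → ¬ (x ≈ 0#) → ∃ λ y → (y * x) ≈ 1#)

  -- Polynomials in R[t] as coefficient lists, constant term first.
  Pol : Set c
  Pol = List Carrier

  coeff : Pol → ℕ → Carrier
  coeff []       n       = 0#
  coeff (a ∷ f)  zero    = a
  coeff (a ∷ f)  (suc n) = coeff f n

  _≃P_ : Pol → Pol → Set ℓ
  f ≃P g = ∀ n → coeff f n ≈ coeff g n

  _+P_ : Pol → Pol → Pol
  []      +P g       = g
  (a ∷ f) +P []      = a ∷ f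
  (a ∷ f) +P (b ∷ g) = (a + b) ∷ (f +P g)

  _*P_ : Pol → Pol → Pol
  []      *P g = []
  (a ∷ f) *P g = map (a *_) g +P (0# ∷ (f *P g))

  compose : Pol → Pol → Pol
  compose f g = foldr (λ a acc → (a ∷ []) +P (g *P acc)) [] f

  HasDegree : Pol → ℕ → Set ℓ
  HasDegree f d = (¬ (coeff f d ≈ 0#)) × (∀ n → d < n → coeff f n ≈ 0#)

  MonicOfDegree : Pol → ℕ → Set ℓ
  MonicOfDegree f d = (coeff f d ≈ 1#) × (∀ n → d < n → coeff f n ≈ 0#)

  IsUnitP : Pol → Set (c ⊔ ℓ)
  IsUnitP g = ∃ λ u → (u *P g) ≃P (1# ∷ [])

  Irreducible : Pol → Set (c ⊔ ℓ)
  Irreducible f = (¬ (f ≃P [])) × (¬ IsUnitP f)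
                × (∀ g h → f ≃P (g *P h) → IsUnitP g ⊎ IsUnitP h)

  WeaklySuperirreducible : ℕ → Pol → Set (c ⊔ ℓ)
  WeaklySuperirreducible k f = ∀ g → HasDegree g k → Irreducible (compose f g)

-- In a field F with p^l elements, p^l · 1 = 0 because translation by 1 permutes F; as F is a
-- field, p · 1 = 0. Hence x ↦ x^p is additive, and being injective on the finite set F it is onto. Replacing each
-- coefficient of f by its p-th root gives h with f(t^p) = h(t)^p, since x ↦ x^p is additive
-- on F[t] as well. A p-th power with p ≥ 2 is never irreducible, so g = t^p, of degree p,
-- shows that no f is weakly p-superirreducible.
module Submission where

open import Defs
open import Level using (Level)
open import Algebra.Bundles using (CommutativeRing; CommutativeSemiring)
open import Algebra.Structures using (IsCommutativeSemiring)
open import Data.List using ([]; _∷_; map)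
open import Data.Product using (_,_; ∃; proj₁; proj₂)
open import Data.Nat as ℕ using (ℕ; zero; suc; NonZero; NonTrivial; _∸_; _<_; _≤_; s≤s; z≤n; _!)
open import Data.Nat.Properties using (_!*_!≢0; n≮n; <⇒≱; <⇒≤; <-trans; n<1+n; ∸-monoʳ-<; n∸n≡0)
open import Data.Nat.Divisibility using (_∣_; divides; ∣-refl; ∣⇒≤; ∣1⇒≡1; m∣m*n)
open import Data.Nat.DivMod using (_/_; m/n*n≡m)
open import Data.Nat.Combinatorics using (_C_; nCk≡n!/k![n-k]!; k![n∸k]!∣n!; nCn≡1)
open import Data.Nat.Primality using (Prime; euclidsLemma; ¬prime[1]; prime⇒nonZero; prime⇒nonTrivial)
open import Data.Fin as Fin using (Fin; toℕ; fromℕ; inject₁)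
open import Data.Fin.Properties as Fin using (toℕ-inject₁; toℕ-fromℕ; toℕ<n; injective⇒≤; punchOut-injective)
open import Data.Fin.Permutation using (Permutation; permutation)
open import Data.Sum using (inj₁; inj₂; [_,_])
open import Data.Empty using (⊥-elim)
open import Function using (id; _∘_; Inverse)
open import Relation.Binary.PropositionalEquality as ≡ using (_≡_; _≢_)
open import Relation.Binary.Definitions using (Decidable)
open import Function.Definitions using (Injective)
open import Relation.Nullary using (¬_; yes; no; contradiction)
import Relation.Nullary.Decidable as Dec

module _ where
  open import Data.Nat using (_*_)

  prime∤m! : ∀ {p m} → Prime p → m < p → ¬ p ∣ m !
  prime∤m! {m = zero}  isPrime _   p∣1 = ¬prime[1] (≡.subst Prime (∣1⇒≡1 p∣1) isPrime)
  prime∤m! {m = suc m} isPrime m<p =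
    [ <⇒≱ m<p ∘ ∣⇒≤ , prime∤m! isPrime (<-trans (n<1+n m) m<p) ] ∘ euclidsLemma (suc m) (m !) isPrime

  n!≡nCk*k!*[n∸k]! : ∀ {n k} → k ≤ n → n ! ≡ (n C k) * (k ! * (n ∸ k) !)
  n!≡nCk*k!*[n∸k]! {n} {k} k≤n = begin
      n !                                         ≡⟨ m/n*n≡m (k![n∸k]!∣n! k≤n) ⟨
      n ! / (k ! * (n ∸ k) !) * (k ! * (n ∸ k) !) ≡⟨ ≡.cong (_* (k ! * (n ∸ k) !)) (nCk≡n!/k![n-k]! k≤n) ⟨
      (n C k) * (k ! * (n ∸ k) !)                 ∎
    where
    open ≡.≡-Reasoning
    instance _ = k !* (n ∸ k) !≢0

  prime∣pCk : ∀ {p k} → Prime p → 0 < k → k < p → p ∣ p C k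
  prime∣pCk {suc p} {k} isPrime 0<k k<p =
    [ id , ⊥-elim ∘ p∤k!*[p∸k]! ] (euclidsLemma (suc p C k) _ isPrime p∣pCk*k!*[p∸k]!)
    where
    p∣pCk*k!*[p∸k]! : suc p ∣ (suc p C k) * (k ! * (suc p ∸ k) !)
    p∣pCk*k!*[p∸k]! = ≡.subst (suc p ∣_) (n!≡nCk*k!*[n∸k]! (<⇒≤ k<p)) (m∣m*n (p !))
    p∤k!*[p∸k]! : ¬ suc p ∣ k ! * (suc p ∸ k) !
    p∤k!*[p∸k]! = [ prime∤m! isPrime k<p , prime∤m! isPrime (∸-monoʳ-< 0<k (<⇒≤ k<p)) ]
                ∘ euclidsLemma _ _ isPrime

module _ {c ℓ : Level} (S : CommutativeSemiring c ℓ) where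
  open CommutativeSemiring S
  open import Algebra.Properties.Semiring.Exp semiring using (_^_)
  open import Algebra.Properties.Semiring.Mult semiring
  open import Algebra.Properties.Monoid.Sum +-monoid using (sum; sum-init-last; sum-cong-≋; sum-replicate-zero)
  open import Algebra.Properties.CommutativeSemiring.Binomial S using (theorem; binomialTerm)
  open import Data.Vec.Functional using (init)
  open import Relation.Binary.Reasoning.Setoid setoid

  ×-annihilated-by-char : ∀ {p n} → p × 1# ≈ 0# → p ∣ n → ∀ x → n × x ≈ 0#
  ×-annihilated-by-char {p} char (divides q ≡.refl) x = begin
    (q ℕ.* p) × x             ≈⟨ ×-congʳ (q ℕ.* p) (*-identityˡ x) ⟨
    (q ℕ.* p) × (1# * x)      ≈⟨ ×-assoc-* (q ℕ.* p) 1# x ⟨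
    ((q ℕ.* p) × 1#) * x      ≈⟨ *-congʳ (×1-homo-* q p) ⟩
    ((q × 1#) * (p × 1#)) * x ≈⟨ *-congʳ (*-congˡ char) ⟩
    ((q × 1#) * 0#) * x       ≈⟨ *-congʳ (zeroʳ _) ⟩
    0# * x                    ≈⟨ zeroˡ x ⟩
    0#                        ∎

  -- Only the two outer terms of the binomial expansion survive: p divides the other coefficients.
  freshmansDream : ∀ {p} → Prime p → p × 1# ≈ 0# → ∀ x y → (x + y) ^ p ≈ x ^ p + y ^ p
  freshmansDream {suc q} isPrime char x y = begin
    (x + y) ^ suc q                                    ≈⟨ theorem (suc q) x y ⟩
    t Fin.zero + sum (λ i → t (Fin.suc i))             ≈⟨ +-congˡ (sum-init-last (λ i → t (Fin.suc i))) ⟩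
    t Fin.zero + (sum (init (λ i → t (Fin.suc i))) + t (Fin.suc (fromℕ q)))
      ≈⟨ +-cong first (+-cong middle last) ⟩
    y ^ suc q + (0# + x ^ suc q)                       ≈⟨ +-congˡ (+-identityˡ _) ⟩
    y ^ suc q + x ^ suc q                              ≈⟨ +-comm _ _ ⟩
    x ^ suc q + y ^ suc q                              ∎
    where
    t : Fin (suc (suc q)) → Carrier
    t = binomialTerm x y (suc q)
    first : t Fin.zero ≈ y ^ suc q
    first = trans (×-homo-1 _) (*-identityˡ _)
    last : t (Fin.suc (fromℕ q)) ≈ x ^ suc q
    last = begin
      (suc q C suc (toℕ (fromℕ q))) × (x ^ suc (toℕ (fromℕ q)) * y ^ (q ∸ toℕ (fromℕ q)))
        ≈⟨ reflexive (≡.cong (λ k → (suc q C suc k) × (x ^ suc k * y ^ (q ∸ k))) (toℕ-fromℕ q)) ⟩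
      (suc q C suc q) × (x ^ suc q * y ^ (q ∸ q))
        ≈⟨ reflexive (≡.cong₂ (λ m k → m × (x ^ suc q * y ^ k)) (nCn≡1 (suc q)) (n∸n≡0 q)) ⟩
      1 × (x ^ suc q * 1#)                             ≈⟨ ×-homo-1 _ ⟩
      x ^ suc q * 1#                                   ≈⟨ *-identityʳ _ ⟩
      x ^ suc q                                        ∎
    middle : sum (init (λ i → t (Fin.suc i))) ≈ 0#
    middle = trans (sum-cong-≋ λ i → ×-annihilated-by-char char (p∣coefficient i) _) (sum-replicate-zero q)
      where
      p∣coefficient : ∀ i → suc q ∣ suc q C suc (toℕ (inject₁ i))
      p∣coefficient i = prime∣pCk isPrime (s≤s z≤n) (≡.subst (λ k → suc k < suc q) (≡.sym (toℕ-inject₁ i)) (s≤s (toℕ<n i)))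

module PolynomialSemiring {c ℓ : Level} (R : CommutativeRing c ℓ) where
  open CommutativeRing R hiding (zero)
  open Poly R
  open import Relation.Binary.Reasoning.Setoid setoid
  open import Algebra.Properties.CommutativeSemigroup +-commutativeSemigroup using (interchange; x∙yz≈y∙xz)

  -- Poly's _≃P_ as a record, so that both polynomials can be inferred from a proof.
  infix 4 _≈P_
  record _≈P_ (f g : Pol) : Set ℓ where
    constructor mk≈P
    field coeff-≈ : ∀ n → coeff f n ≈ coeff g n
  open _≈P_ public

  scale : Carrier → Pol → Pol
  scale a = map (a *_)

  ≈P-refl : ∀ {f} → f ≈P f
  ≈P-refl = mk≈P λ _ → refl

  ≈P-sym : ∀ {f g} → f ≈P g → g ≈P f
  ≈P-sym f≈g = mk≈P λ n → sym (coeff-≈ f≈g n)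

  ≈P-trans : ∀ {f g h} → f ≈P g → g ≈P h → f ≈P h
  ≈P-trans f≈g g≈h = mk≈P λ n → trans (coeff-≈ f≈g n) (coeff-≈ g≈h n)

  coeff-+P : ∀ f g n → coeff (f +P g) n ≈ coeff f n + coeff g n
  coeff-+P []      g       n       = sym (+-identityˡ _)
  coeff-+P (a ∷ f) []      zero    = sym (+-identityʳ _)
  coeff-+P (a ∷ f) []      (suc n) = sym (+-identityʳ _)
  coeff-+P (a ∷ f) (b ∷ g) zero    = refl
  coeff-+P (a ∷ f) (b ∷ g) (suc n) = coeff-+P f g n

  coeff-scale : ∀ a g n → coeff (scale a g) n ≈ a * coeff g n
  coeff-scale a []      n       = sym (zeroʳ a)
  coeff-scale a (b ∷ g) zero    = refl
  coeff-scale a (b ∷ g) (suc n) = coeff-scale a g n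

  coeff-0∷-scale : ∀ a f n → coeff (0# ∷ scale a f) n ≈ a * coeff (0# ∷ f) n
  coeff-0∷-scale a f zero    = sym (zeroʳ a)
  coeff-0∷-scale a f (suc n) = coeff-scale a f n

  coeff-0∷-+P : ∀ f g n → coeff (0# ∷ (f +P g)) n ≈ coeff (0# ∷ f) n + coeff (0# ∷ g) n
  coeff-0∷-+P f g zero    = sym (+-identityˡ _)
  coeff-0∷-+P f g (suc n) = coeff-+P f g n

  coeff-0∷[] : ∀ n → coeff (0# ∷ []) n ≈ 0#
  coeff-0∷[] zero    = refl
  coeff-0∷[] (suc n) = refl

  coeff-*P : ∀ a f g n → coeff ((a ∷ f) *P g) n ≈ a * coeff g n + coeff (0# ∷ (f *P g)) n
  coeff-*P a f g n = trans (coeff-+P (scale a g) (0# ∷ (f *P g)) n) (+-congʳ (coeff-scale a g n))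

  ∷-cong : ∀ {a b f g} → a ≈ b → f ≈P g → (a ∷ f) ≈P (b ∷ g)
  ∷-cong a≈b f≈g = mk≈P λ where
    zero    → a≈b
    (suc n) → coeff-≈ f≈g n

  ∷-injectiveʳ : ∀ {a b f g} → (a ∷ f) ≈P (b ∷ g) → f ≈P g
  ∷-injectiveʳ a∷f≈b∷g = mk≈P λ n → coeff-≈ a∷f≈b∷g (suc n)

  +P-cong : ∀ {f f′ g g′} → f ≈P f′ → g ≈P g′ → (f +P g) ≈P (f′ +P g′)
  +P-cong {f} {f′} {g} {g′} f≈f′ g≈g′ = mk≈P λ n →
    trans (coeff-+P f g n) (trans (+-cong (coeff-≈ f≈f′ n) (coeff-≈ g≈g′ n)) (sym (coeff-+P f′ g′ n)))

  scale-cong : ∀ {a b f g} → a ≈ b → f ≈P g → scale a f ≈P scale b g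
  scale-cong {a} {b} {f} {g} a≈b f≈g = mk≈P λ n →
    trans (coeff-scale a f n) (trans (*-cong a≈b (coeff-≈ f≈g n)) (sym (coeff-scale b g n)))

  *P-congʳ : ∀ f {g g′} → g ≈P g′ → (f *P g) ≈P (f *P g′)
  *P-congʳ []      g≈g′ = ≈P-refl
  *P-congʳ (a ∷ f) g≈g′ = +P-cong (scale-cong refl g≈g′) (∷-cong refl (*P-congʳ f g≈g′))

  *P-zeroˡ-≈ : ∀ {f} g → f ≈P [] → (f *P g) ≈P []
  *P-zeroˡ-≈ {[]}    g f≈0 = ≈P-refl
  *P-zeroˡ-≈ {a ∷ f} g f≈0 = mk≈P λ n → begin
    coeff ((a ∷ f) *P g) n                  ≈⟨ coeff-*P a f g n ⟩
    a * coeff g n + coeff (0# ∷ (f *P g)) n ≈⟨ +-cong (*-congʳ (coeff-≈ f≈0 zero)) (coeff-≈ (∷-cong refl f*g≈0) n) ⟩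
    0# * coeff g n + coeff (0# ∷ []) n      ≈⟨ +-cong (zeroˡ _) (coeff-0∷[] n) ⟩
    0# + 0#                                 ≈⟨ +-identityˡ _ ⟩
    0#                                      ∎
    where
    f*g≈0 : (f *P g) ≈P []
    f*g≈0 = *P-zeroˡ-≈ {f} g (mk≈P λ m → coeff-≈ f≈0 (suc m))

  *P-congˡ : ∀ {f f′} g → f ≈P f′ → (f *P g) ≈P (f′ *P g)
  *P-congˡ {[]}    {[]}      g f≈f′ = ≈P-refl
  *P-congˡ {[]}    {a′ ∷ f′} g f≈f′ = ≈P-sym (*P-zeroˡ-≈ g (≈P-sym f≈f′))
  *P-congˡ {a ∷ f} {[]}      g f≈f′ = *P-zeroˡ-≈ g f≈f′
  *P-congˡ {a ∷ f} {a′ ∷ f′} g f≈f′ =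
    +P-cong (scale-cong (coeff-≈ f≈f′ zero) ≈P-refl) (∷-cong refl (*P-congˡ g (∷-injectiveʳ f≈f′)))

  *P-cong : ∀ {f f′ g g′} → f ≈P f′ → g ≈P g′ → (f *P g) ≈P (f′ *P g′)
  *P-cong {f′ = f′} {g = g} f≈f′ g≈g′ = ≈P-trans (*P-congˡ g f≈f′) (*P-congʳ f′ g≈g′)

  +P-assoc : ∀ f g h → ((f +P g) +P h) ≈P (f +P (g +P h))
  +P-assoc f g h = mk≈P λ n → begin
    coeff ((f +P g) +P h) n             ≈⟨ trans (coeff-+P (f +P g) h n) (+-congʳ (coeff-+P f g n)) ⟩
    coeff f n + coeff g n + coeff h n   ≈⟨ +-assoc _ _ _ ⟩
    coeff f n + (coeff g n + coeff h n) ≈⟨ trans (coeff-+P f (g +P h) n) (+-congˡ (coeff-+P g h n)) ⟨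
    coeff (f +P (g +P h)) n             ∎

  +P-comm : ∀ f g → (f +P g) ≈P (g +P f)
  +P-comm f g = mk≈P λ n → trans (coeff-+P f g n) (trans (+-comm _ _) (sym (coeff-+P g f n)))

  +P-identityʳ : ∀ f → (f +P []) ≈P f
  +P-identityʳ f = mk≈P λ n → trans (coeff-+P f [] n) (+-identityʳ _)

  *P-distribʳ : ∀ h f g → ((f +P g) *P h) ≈P ((f *P h) +P (g *P h))
  *P-distribʳ h []      g       = ≈P-refl
  *P-distribʳ h (a ∷ f) []      = ≈P-sym (+P-identityʳ _)
  *P-distribʳ h (a ∷ f) (b ∷ g) = mk≈P λ n → begin
    coeff (((a + b) ∷ (f +P g)) *P h) n
      ≈⟨ coeff-*P (a + b) (f +P g) h n ⟩
    (a + b) * coeff h n + coeff (0# ∷ ((f +P g) *P h)) n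
      ≈⟨ +-cong (distribʳ _ _ _) (trans (coeff-≈ (∷-cong refl (*P-distribʳ h f g)) n) (coeff-0∷-+P (f *P h) (g *P h) n)) ⟩
    (a * coeff h n + b * coeff h n) + (coeff (0# ∷ (f *P h)) n + coeff (0# ∷ (g *P h)) n)
      ≈⟨ interchange _ _ _ _ ⟩
    (a * coeff h n + coeff (0# ∷ (f *P h)) n) + (b * coeff h n + coeff (0# ∷ (g *P h)) n)
      ≈⟨ +-cong (coeff-*P a f h n) (coeff-*P b g h n) ⟨
    coeff ((a ∷ f) *P h) n + coeff ((b ∷ g) *P h) n
      ≈⟨ coeff-+P ((a ∷ f) *P h) ((b ∷ g) *P h) n ⟨
    coeff (((a ∷ f) *P h) +P ((b ∷ g) *P h)) n ∎

  *P-distribˡ : ∀ f g h → (f *P (g +P h)) ≈P ((f *P g) +P (f *P h))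
  *P-distribˡ []      g h = ≈P-refl
  *P-distribˡ (a ∷ f) g h = mk≈P λ n → begin
    coeff ((a ∷ f) *P (g +P h)) n
      ≈⟨ coeff-*P a f (g +P h) n ⟩
    a * coeff (g +P h) n + coeff (0# ∷ (f *P (g +P h))) n
      ≈⟨ +-cong (trans (*-congˡ (coeff-+P g h n)) (distribˡ _ _ _))
                (trans (coeff-≈ (∷-cong refl (*P-distribˡ f g h)) n) (coeff-0∷-+P (f *P g) (f *P h) n)) ⟩
    (a * coeff g n + a * coeff h n) + (coeff (0# ∷ (f *P g)) n + coeff (0# ∷ (f *P h)) n)
      ≈⟨ interchange _ _ _ _ ⟩
    (a * coeff g n + coeff (0# ∷ (f *P g)) n) + (a * coeff h n + coeff (0# ∷ (f *P h)) n)
      ≈⟨ +-cong (coeff-*P a f g n) (coeff-*P a f h n) ⟨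
    coeff ((a ∷ f) *P g) n + coeff ((a ∷ f) *P h) n
      ≈⟨ coeff-+P ((a ∷ f) *P g) ((a ∷ f) *P h) n ⟨
    coeff (((a ∷ f) *P g) +P ((a ∷ f) *P h)) n ∎

  scale-*P : ∀ a f g → scale a (f *P g) ≈P (scale a f *P g)
  scale-*P a []       g = ≈P-refl
  scale-*P a (a′ ∷ f) g = mk≈P λ n → begin
    coeff (scale a ((a′ ∷ f) *P g)) n                     ≈⟨ coeff-scale a ((a′ ∷ f) *P g) n ⟩
    a * coeff ((a′ ∷ f) *P g) n                           ≈⟨ *-congˡ (coeff-*P a′ f g n) ⟩
    a * (a′ * coeff g n + coeff (0# ∷ (f *P g)) n)        ≈⟨ distribˡ _ _ _ ⟩
    a * (a′ * coeff g n) + a * coeff (0# ∷ (f *P g)) n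
      ≈⟨ +-cong (sym (*-assoc _ _ _)) (trans (sym (coeff-0∷-scale a (f *P g) n)) (coeff-≈ (∷-cong refl (scale-*P a f g)) n)) ⟩
    (a * a′) * coeff g n + coeff (0# ∷ (scale a f *P g)) n ≈⟨ coeff-*P (a * a′) (scale a f) g n ⟨
    coeff (scale a (a′ ∷ f) *P g) n                       ∎

  *P-zeroʳ : ∀ f → (f *P []) ≈P []
  *P-zeroʳ []      = ≈P-refl
  *P-zeroʳ (a ∷ f) = mk≈P λ where
    zero    → refl
    (suc n) → coeff-≈ (*P-zeroʳ f) n

  *P-∷ʳ : ∀ f b g → (f *P (b ∷ g)) ≈P (scale b f +P (0# ∷ (f *P g)))
  *P-∷ʳ []      b g = mk≈P λ n → sym (coeff-0∷[] n)
  *P-∷ʳ (a ∷ f) b g = ∷-cong (+-congʳ (*-comm a b)) (mk≈P λ n → begin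
    coeff (scale a g +P (f *P (b ∷ g))) n
      ≈⟨ coeff-+P (scale a g) _ n ⟩
    coeff (scale a g) n + coeff (f *P (b ∷ g)) n
      ≈⟨ +-congˡ (trans (coeff-≈ (*P-∷ʳ f b g) n) (coeff-+P (scale b f) _ n)) ⟩
    coeff (scale a g) n + (coeff (scale b f) n + coeff (0# ∷ (f *P g)) n)
      ≈⟨ x∙yz≈y∙xz _ _ _ ⟩
    coeff (scale b f) n + (coeff (scale a g) n + coeff (0# ∷ (f *P g)) n)
      ≈⟨ +-congˡ (coeff-+P (scale a g) _ n) ⟨
    coeff (scale b f) n + coeff ((a ∷ f) *P g) n
      ≈⟨ coeff-+P (scale b f) _ n ⟨
    coeff (scale b f +P ((a ∷ f) *P g)) n ∎)

  *P-comm : ∀ f g → (f *P g) ≈P (g *P f)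
  *P-comm []      g = ≈P-sym (*P-zeroʳ g)
  *P-comm (a ∷ f) g = ≈P-trans (+P-cong ≈P-refl (∷-cong refl (*P-comm f g))) (≈P-sym (*P-∷ʳ g a f))

  0∷-*P : ∀ f g → ((0# ∷ f) *P g) ≈P (0# ∷ (f *P g))
  0∷-*P f g = +P-cong {scale 0# g} {[]} (mk≈P λ n → trans (coeff-scale 0# g n) (zeroˡ _)) ≈P-refl

  *P-assoc : ∀ f g h → ((f *P g) *P h) ≈P (f *P (g *P h))
  *P-assoc []      g h = ≈P-refl
  *P-assoc (a ∷ f) g h =
    ≈P-trans (*P-distribʳ h (scale a g) (0# ∷ (f *P g)))
      (+P-cong (≈P-sym (scale-*P a g h)) (≈P-trans (0∷-*P (f *P g) h) (∷-cong refl (*P-assoc f g h))))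

  *P-identityˡ : ∀ f → ((1# ∷ []) *P f) ≈P f
  *P-identityˡ f = mk≈P λ n → begin
    coeff ((1# ∷ []) *P f) n           ≈⟨ coeff-*P 1# [] f n ⟩
    1# * coeff f n + coeff (0# ∷ []) n ≈⟨ +-cong (*-identityˡ _) (coeff-0∷[] n) ⟩
    coeff f n + 0#                     ≈⟨ +-identityʳ _ ⟩
    coeff f n                          ∎

  Pol-isCommutativeSemiring : IsCommutativeSemiring _≈P_ _+P_ _*P_ [] (1# ∷ [])
  Pol-isCommutativeSemiring = record
    { isSemiring = record
      { isSemiringWithoutAnnihilatingZero = record
        { +-isCommutativeMonoid = record
          { isMonoid = record
            { isSemigroup = record
              { isMagma = record
                { isEquivalence = record { refl = ≈P-refl ; sym = ≈P-sym ; trans = ≈P-trans }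
                ; ∙-cong = +P-cong }
              ; assoc = +P-assoc }
            ; identity = (λ _ → ≈P-refl) , +P-identityʳ }
          ; comm = +P-comm }
        ; *-cong = *P-cong
        ; *-assoc = *P-assoc
        ; *-identity = *P-identityˡ , (λ f → ≈P-trans (*P-comm f _) (*P-identityˡ f))
        ; distrib = *P-distribˡ , *P-distribʳ }
      ; zero = (λ _ → ≈P-refl) , *P-zeroʳ }
    ; *-comm = *P-comm }

  Pol-commutativeSemiring : CommutativeSemiring c ℓ
  Pol-commutativeSemiring = record { isCommutativeSemiring = Pol-isCommutativeSemiring }

module PolynomialPowers {c ℓ : Level} (R : CommutativeRing c ℓ) where
  open CommutativeRing R hiding (zero)
  open Poly R
  open PolynomialSemiring R
  open import Algebra.Properties.Semiring.Exp semiring using (_^_)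
  module P = CommutativeSemiring Pol-commutativeSemiring
  open import Algebra.Properties.Semiring.Exp P.semiring using () renaming (_^_ to _^P_; ^-congˡ to ^P-congˡ)
  open import Algebra.Properties.CommutativeSemiring.Exp Pol-commutativeSemiring using () renaming (^-distrib-* to ^P-distrib-*P)
  open import Algebra.Properties.CommutativeSemigroup P.*-commutativeSemigroup using () renaming (interchange to *P-interchange)

  inverse-*P : ∀ {f} (f-unit : IsUnitP f) → (proj₁ f-unit *P f) ≈P P.1#
  inverse-*P (_ , u*f≈1) = mk≈P u*f≈1

  IsUnitP-resp-≈P : ∀ {f g} → f ≈P g → IsUnitP f → IsUnitP g
  IsUnitP-resp-≈P f≈g f-unit@(u , _) = u , coeff-≈ (≈P-trans (*P-congʳ u (≈P-sym f≈g)) (inverse-*P f-unit))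

  IsUnitP-*P : ∀ {f g} → IsUnitP f → IsUnitP g → IsUnitP (f *P g)
  IsUnitP-*P {f} {g} f-unit@(u , _) g-unit@(v , _) = u *P v , coeff-≈ (P.trans (*P-interchange u v f g)
    (P.trans (*P-cong (inverse-*P f-unit) (inverse-*P g-unit)) (*P-identityˡ P.1#)))

  IsUnitP-^P : ∀ {f} → IsUnitP f → ∀ n → IsUnitP (f ^P n)
  IsUnitP-^P f-unit zero    = P.1# , coeff-≈ (*P-identityˡ P.1#)
  IsUnitP-^P f-unit (suc n) = IsUnitP-*P f-unit (IsUnitP-^P f-unit n)

  -- Both factors of H * H ^P (n ∸ 1) are units as soon as one is, and then so is H ^P n.
  ¬Irreducible-^P : ∀ {f} H n .{{_ : NonTrivial n}} → f ≈P H ^P n → ¬ Irreducible f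
  ¬Irreducible-^P H n@(suc (suc m)) f≈Hⁿ (_ , f-nonunit , f-irreducible) =
    f-nonunit (IsUnitP-resp-≈P (P.sym f≈Hⁿ) (IsUnitP-^P H-unit n))
    where
    H-unit : IsUnitP H
    H-unit with f-irreducible H (H *P (H ^P m)) (coeff-≈ f≈Hⁿ)
    ... | inj₁ H-unit                 = H-unit
    ... | inj₂ H*Hᵐ-unit@(u , _) = u *P (H ^P m) , coeff-≈ (P.trans (*P-assoc u (H ^P m) H)
                                       (P.trans (*P-congʳ u (*P-comm (H ^P m) H)) (inverse-*P H*Hᵐ-unit)))

  infix 30 t^_
  t^_ : ℕ → Pol
  t^ zero    = 1# ∷ []
  t^ (suc k) = 0# ∷ t^ k

  coeff-t^-self : ∀ k → coeff (t^ k) k ≈ 1#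
  coeff-t^-self zero    = refl
  coeff-t^-self (suc k) = coeff-t^-self k

  coeff-t^-above : ∀ k n → k < n → coeff (t^ k) n ≈ 0#
  coeff-t^-above zero    (suc n) _         = refl
  coeff-t^-above (suc k) (suc n) (s≤s k<n) = coeff-t^-above k n k<n

  t^-hasDegree : ¬ (1# ≈ 0#) → ∀ k → HasDegree (t^ k) k
  t^-hasDegree 1≉0 k = (λ tᵏ[k]≈0 → 1≉0 (trans (sym (coeff-t^-self k)) tᵏ[k]≈0)) , coeff-t^-above k

  t*P : ∀ f → (t^ 1 *P f) ≈P (0# ∷ f)
  t*P f = mk≈P λ n → trans (coeff-*P 0# (1# ∷ []) f n)
    (trans (+-cong (zeroˡ _) (coeff-≈ (∷-cong refl (*P-identityˡ f)) n)) (+-identityˡ _))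

  t^-≈-^P : ∀ k → (t^ 1 ^P k) ≈P t^ k
  t^-≈-^P zero    = ≈P-refl
  t^-≈-^P (suc k) = ≈P-trans (*P-congʳ (t^ 1) (t^-≈-^P k)) (t*P (t^ k))

  ∷-≈-+P : ∀ a f → (a ∷ f) ≈P ((a ∷ []) +P (t^ 1 *P f))
  ∷-≈-+P a f = ≈P-sym (≈P-trans (+P-cong {a ∷ []} ≈P-refl (t*P f)) (∷-cong (+-identityʳ a) ≈P-refl))

  constant-*P : ∀ a b → ((a ∷ []) *P (b ∷ [])) ≈P ((a * b) ∷ [])
  constant-*P a b = ∷-cong (+-identityʳ _) ≈P-refl

  constant-^P : ∀ a k → ((a ∷ []) ^P k) ≈P ((a ^ k) ∷ [])
  constant-^P a zero    = ≈P-refl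
  constant-^P a (suc k) = ≈P-trans (*P-congʳ (a ∷ []) (constant-^P a k)) (constant-*P a (a ^ k))

  open import Algebra.Properties.Semiring.Mult semiring using (_×_)
  open import Algebra.Properties.Semiring.Mult P.semiring using () renaming (_×_ to _×P_)

  coeff-×P : ∀ n f m → coeff (n ×P f) m ≈ n × coeff f m
  coeff-×P zero    f m = refl
  coeff-×P (suc n) f m = trans (coeff-+P f (n ×P f) m) (+-congˡ (coeff-×P n f m))

  []-^P : ∀ n .{{_ : NonZero n}} → ([] ^P n) ≈P []
  []-^P (suc n) = ≈P-refl

  module _ {p : ℕ} (isPrime : Prime p) (char : p × 1# ≈ 0#)
           (root : Carrier → Carrier) (root-^ : ∀ a → root a ^ p ≈ a) where
    open import Relation.Binary.Reasoning.Setoid P.setoid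

    Pol-char : (p ×P P.1#) ≈P []
    Pol-char = mk≈P λ m → trans (coeff-×P p P.1# m) (×-annihilated-by-char commutativeSemiring {p} char ∣-refl _)

    compose-t^p : ∀ f → compose f (t^ p) ≈P (map root f ^P p)
    compose-t^p []      = ≈P-sym ([]-^P p {{prime⇒nonZero isPrime}})
    compose-t^p (a ∷ f) = begin
      (a ∷ []) +P (t^ p *P compose f (t^ p))
        ≈⟨ +P-cong (∷-cong (sym (root-^ a)) ≈P-refl) (*P-cong (≈P-sym (t^-≈-^P p)) (compose-t^p f)) ⟩
      ((root a ^ p) ∷ []) +P ((t^ 1 ^P p) *P (map root f ^P p))
        ≈⟨ +P-cong (≈P-sym (constant-^P (root a) p)) (≈P-sym (^P-distrib-*P (t^ 1) (map root f) p)) ⟩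
      ((root a ∷ []) ^P p) +P ((t^ 1 *P map root f) ^P p)
        ≈⟨ freshmansDream Pol-commutativeSemiring isPrime Pol-char (root a ∷ []) (t^ 1 *P map root f) ⟨
      ((root a ∷ []) +P (t^ 1 *P map root f)) ^P p
        ≈⟨ ^P-congˡ p (∷-≈-+P (root a) (map root f)) ⟨
      (root a ∷ map root f) ^P p ∎

Fin-injective⇒surjective : ∀ {n} (f : Fin n → Fin n) → Injective _≡_ _≡_ f → ∀ i → ∃ λ j → f j ≡ i
Fin-injective⇒surjective {suc m} f f-injective i with Fin.any? (λ j → f j Fin.≟ i)
... | yes hit  = hit
... | no ¬hit = contradiction (injective⇒≤ g-injective) (n≮n m)
  where
  f≢i : ∀ j → i ≢ f j
  f≢i j i≡fj = ¬hit (j , ≡.sym i≡fj)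
  -- f misses i, so it injects Fin (suc m) into Fin (suc m) ∖ {i} ≅ Fin m.
  g : Fin (suc m) → Fin m
  g j = Fin.punchOut (f≢i j)
  g-injective : Injective _≡_ _≡_ g
  g-injective gx≡gy = f-injective (punchOut-injective (f≢i _) (f≢i _) gx≡gy)

module FiniteRing {c ℓ : Level} (R : CommutativeRing c ℓ) {n : ℕ}
                  (enum : Inverse (≡.setoid (Fin n)) (CommutativeRing.setoid R)) where
  open CommutativeRing R
  open import Algebra.Properties.Ring ring using (+-identityʳ-unique; //-rightDividesˡ; //-rightDividesʳ)
  open import Algebra.Properties.Semiring.Mult semiring using (_×_)
  open import Algebra.Properties.CommutativeMonoid.Sum +-commutativeMonoid
    using (sum; sum-permute; sum-cong-≋; ∑-distrib-+; sum-replicate)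
  open import Relation.Binary.Reasoning.Setoid setoid
  open Inverse enum
  open import Data.Vec.Functional using (replicate)

  from-injective : ∀ {x y} → from x ≡ from y → x ≈ y
  from-injective {x} {y} fx≡fy = trans (sym (strictlyInverseˡ x)) (trans (to-cong fx≡fy) (strictlyInverseˡ y))

  _≟_ : Decidable _≈_
  x ≟ y = Dec.map′ from-injective from-cong (from x Fin.≟ from y)

  injective⇒surjective : ∀ (f : Carrier → Carrier) → (∀ {x y} → f x ≈ f y → x ≈ y)
                       → ∀ y → ∃ λ x → f x ≈ y
  injective⇒surjective f f-injective y =
    let j , φj≡y = Fin-injective⇒surjective φ φ-injective (from y) in to j , from-injective φj≡y
    where
    φ : Fin n → Fin n
    φ i = from (f (to i))
    φ-injective : Injective _≡_ _≡_ φ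
    φ-injective {i} {j} φi≡φj = ≡.trans (≡.sym (strictlyInverseʳ i))
      (≡.trans (from-cong (f-injective (from-injective φi≡φj))) (strictlyInverseʳ j))

  -- Translation by x permutes R, so Σ a ≈ Σ (a + x) ≈ Σ a + n × x.
  card×x≈0 : ∀ x → n × x ≈ 0#
  card×x≈0 x = +-identityʳ-unique (sum to) (n × x) (sym (begin
    sum to                           ≈⟨ sum-permute to translation ⟩
    sum (λ i → to (from (to i + x))) ≈⟨ sum-cong-≋ {n} (λ i → strictlyInverseˡ (to i + x)) ⟩
    sum (λ i → to i + x)             ≈⟨ ∑-distrib-+ to (λ _ → x) ⟩
    sum to + sum (replicate n x)     ≈⟨ +-congˡ (sum-replicate n) ⟩
    sum to + n × x                   ∎))
    where
    translation : Permutation n n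
    translation = permutation (λ i → from (to i + x)) (λ i → from (to i - x))
      (λ i → ≡.trans (from-cong (trans (+-congʳ (strictlyInverseˡ _)) (//-rightDividesˡ x (to i)))) (strictlyInverseʳ i))
      (λ i → ≡.trans (from-cong (trans (+-congʳ (strictlyInverseˡ _)) (//-rightDividesʳ x (to i)))) (strictlyInverseʳ i))

module DecidableField {c ℓ : Level} (F : CommutativeRing c ℓ) (isField : Poly.IsField F)
                      (_≟_ : Decidable (CommutativeRing._≈_ F)) where
  open CommutativeRing F
  open import Algebra.Properties.Ring ring using (+-identityˡ-unique; //-rightDividesˡ; x∙y⁻¹≈ε⇒x≈y)
  open import Algebra.Properties.Semiring.Exp semiring using (_^_; ^-congˡ)
  open import Algebra.Properties.Semiring.Mult semiring using (_×_; ×1-homo-*)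
  open import Relation.Binary.Reasoning.Setoid setoid

  *-nonzero : ∀ {x y} → ¬ x ≈ 0# → ¬ y ≈ 0# → ¬ x * y ≈ 0#
  *-nonzero {x} {y} x≉0 y≉0 xy≈0 = y≉0 (begin
    y             ≈⟨ *-identityˡ y ⟨
    1# * y        ≈⟨ *-congʳ x⁻¹x≈1 ⟨
    x⁻¹ * x * y   ≈⟨ *-assoc x⁻¹ x y ⟩
    x⁻¹ * (x * y) ≈⟨ *-congˡ xy≈0 ⟩
    x⁻¹ * 0#      ≈⟨ zeroʳ x⁻¹ ⟩
    0#            ∎)
    where
    x⁻¹ : Carrier
    x⁻¹ = proj₁ (proj₂ isField x x≉0)
    x⁻¹x≈1 : x⁻¹ * x ≈ 1#
    x⁻¹x≈1 = proj₂ (proj₂ isField x x≉0)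

  ^-nonzero : ∀ {x} n → ¬ x ≈ 0# → ¬ x ^ n ≈ 0#
  ^-nonzero zero    x≉0 = proj₁ isField
  ^-nonzero (suc n) x≉0 = *-nonzero x≉0 (^-nonzero n x≉0)

  ^≈0⇒≈0 : ∀ {x} n → x ^ n ≈ 0# → x ≈ 0#
  ^≈0⇒≈0 {x} n xⁿ≈0 with x ≟ 0#
  ... | yes x≈0 = x≈0
  ... | no  x≉0 = contradiction xⁿ≈0 (^-nonzero n x≉0)

  ×1-homo-^ : ∀ m n → (m × 1#) ^ n ≈ (m ℕ.^ n) × 1#
  ×1-homo-^ m zero    = sym (+-identityʳ 1#)
  ×1-homo-^ m (suc n) = trans (*-congˡ (×1-homo-^ m n)) (sym (×1-homo-* m (m ℕ.^ n)))

  pˡ×1≈0⇒p×1≈0 : ∀ p l → (p ℕ.^ l) × 1# ≈ 0# → p × 1# ≈ 0#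
  pˡ×1≈0⇒p×1≈0 p l pˡ≈0 = ^≈0⇒≈0 l (trans (×1-homo-^ p l) pˡ≈0)

  frobenius-injective : ∀ {p} → Prime p → p × 1# ≈ 0# → ∀ {x y} → x ^ p ≈ y ^ p → x ≈ y
  frobenius-injective {p} isPrime char {x} {y} xᵖ≈yᵖ = x∙y⁻¹≈ε⇒x≈y x y (^≈0⇒≈0 p
    (+-identityˡ-unique ((x - y) ^ p) (y ^ p) (begin
      (x - y) ^ p + y ^ p ≈⟨ freshmansDream commutativeSemiring isPrime char (x - y) y ⟨
      (x - y + y) ^ p     ≈⟨ ^-congˡ p (//-rightDividesˡ y x) ⟩
      x ^ p               ≈⟨ xᵖ≈yᵖ ⟩
      y ^ p               ∎)))

module FiniteField {c ℓ : Level} (F : CommutativeRing c ℓ) (isField : Poly.IsField F) {n : ℕ}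
                   (enum : Inverse (≡.setoid (Fin n)) (CommutativeRing.setoid F)) where
  open CommutativeRing F
  open import Algebra.Properties.Semiring.Exp semiring using (_^_)
  open import Algebra.Properties.Semiring.Mult semiring using (_×_)
  open FiniteRing F enum public
  open DecidableField F isField _≟_ public

  frobenius-surjective : ∀ {p} → Prime p → p × 1# ≈ 0# → ∀ a → ∃ λ r → r ^ p ≈ a
  frobenius-surjective {p} isPrime char =
    injective⇒surjective (_^ p) (frobenius-injective isPrime char)

open import Data.Nat using (_^_)
open import Relation.Binary.PropositionalEquality using (setoid)

proposition3p1 : {c ℓ : Level} (p : ℕ) → Prime p → (l d : ℕ)
    → (F : CommutativeRing c ℓ) → Poly.IsField F
    → Inverse (setoid (Fin (p ^ l))) (CommutativeRing.setoid F)
    → (f : Poly.Pol F) → Poly.MonicOfDegree F f d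
    → ¬ Poly.WeaklySuperirreducible F p f
proposition3p1 p isPrime l _ F isField enum f _ f-superirreducible =
  ¬Irreducible-^P (map root f) p {{prime⇒nonTrivial isPrime}}
    (compose-t^p isPrime char root (proj₂ ∘ frobenius-surjective isPrime char) f)
    (f-superirreducible (t^ p) (t^-hasDegree (proj₁ isField) p))
  where
  open CommutativeRing F using (Carrier; _≈_; 1#; 0#; semiring)
  open import Algebra.Properties.Semiring.Mult semiring using (_×_)
  open FiniteField F isField enum
  open PolynomialPowers F
  char : p × 1# ≈ 0#
  char = pˡ×1≈0⇒p×1≈0 p l (card×x≈0 1#)
  root : Carrier → Carrier
  root = proj₁ ∘ frobenius-surjective isPrime char
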